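{- Let $n\ge 8$ be even and $\{n-1\}\subseteq I\subseteq\{2,3,\ldots,n-1\}$. Then $$\lambda^I_{(1^n)}-\lambda^I_{(n-1,1)}>\frac{n(n-5)}{3}(n-3)!.$$
   Context: For $\emptyset\ne I\subseteq\{2,\ldots,n\}$, $\lambda^I_{(1^n)}=\sum_{k\in I}\binom nk(k-1)!(-1)^{k-1}$ and $\lambda^I_{(n-1,1)}=\sum_{k\in I}\binom nk(k-1)!\frac{n-k-1}{n-1}$; these are the eigenvalues of the Cayley graph on $S_n$ generated by all cycles with length in $I$ corresponding to the sign and standard representations. -}

module Defs where

open import Data.Nat using (ℕ; zero; suc; _!; _∸_)
import Data.Nat as ℕ
open import Data.Nat.Combinatorics using (_C_)
open import Data.Integer using (ℤ; +_; -_)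
import Data.Integer as ℤ
open import Data.Rational using (ℚ; _/_; _+_; _*_; _-_; 0ℚ)
open import Data.Bool using (Bool; if_then_else_)

-- z / d as a rational, with the (irrelevant) convention z / 0 = 0
-- (only used with d = n - 1 ≥ 7 below).
div : ℤ → ℕ → ℚ
div z zero    = 0ℚ
div z (suc d) = z / suc d

ℕ→ℚ : ℕ → ℚ
ℕ→ℚ m = (+ m) / 1

ℤ→ℚ : ℤ → ℚ
ℤ→ℚ z = z / 1

sumFrom : ℕ → ℕ → (ℕ → ℚ) → ℚ
sumFrom a zero      f = 0ℚ
sumFrom a (suc len) f = f a + sumFrom (suc a) len f

-- Σ_{k ∈ I, 2 ≤ k ≤ n} g k, where I ⊆ ℕ is given by its indicator function
sumOver : (n : ℕ) → (I : ℕ → Bool) → (ℕ → ℚ) → ℚ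
sumOver n I g = sumFrom 2 (n ∸ 1) (λ k → if I k then g k else 0ℚ)

signℤ : ℕ → ℤ
signℤ zero          = + 1
signℤ (suc zero)    = - (+ 1)
signℤ (suc (suc m)) = signℤ m

lamSign : (n : ℕ) → (I : ℕ → Bool) → ℚ
lamSign n I = sumOver n I (λ k →
  ℕ→ℚ ((n C k) ℕ.* (k ∸ 1) !) * ℤ→ℚ (signℤ (k ∸ 1)))

lamStd : (n : ℕ) → (I : ℕ → Bool) → ℚ
lamStd n I = sumOver n I (λ k →
  ℕ→ℚ ((n C k) ℕ.* (k ∸ 1) !)
    * div ((+ n) ℤ.- (+ k) ℤ.- (+ 1)) (n ∸ 1))

-- Multiplying by n - 1 turns λ_{(1^n)} - λ_{(n-1,1)} into the integer Σ_{k∈I} T_k g_k, where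
-- T_k = C(n,k)(k-1)! counts k-cycles and g_k = (-1)^{k-1}(n-1) - (n-k-1). Keep the term k = n - 1,
-- drop every other positive term and bound the negative ones by g_k ≥ -2(n-1). Since
-- T_{k+1} ≥ (5/2) T_k for k ≤ n - 5, the negative terms up to k = n - 4 telescope into
-- -10(n-1) T_{n-4}/3, and together with the term k = n - 2 they are beaten by (n-1) T_{n-1} = n!
-- with room for n(n-5)(n-3)!(n-1)/3 as soon as n ≥ 20; the even n from 8 to 18 are evaluated.
module Submission where

open import Defs
open import Data.Nat using (ℕ; _≤_; _∸_; _!) renaming (_*_ to _*ℕ_)
open import Data.Nat.Divisibility using (_∣_)
open import Data.Bool using (Bool; true)
open import Data.Product using (_×_)
open import Data.Rational using (ℚ; _<_; _-_; _*_; _/_)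
open import Data.Integer using (+_)
open import Relation.Binary.PropositionalEquality using (_≡_)

open import Data.Bool using (false; if_then_else_)
open import Data.Empty using (⊥-elim)
open import Data.Integer as ℤ using (ℤ; 0ℤ; _⊓_; +≤+; +<+)
import Data.Integer.Properties as ℤP
import Data.Integer.Tactic.RingSolver as ℤ-Solver
open import Data.Nat as ℕ using (zero; suc; z≤n; s≤s)
open import Data.Nat.Combinatorics using (_C_; nCk≡n!/k![n-k]!; k![n∸k]!∣n!; [n-k]*[n-k-1]!≡[n-k]!)
open import Data.Nat.Divisibility using (divides)
open import Data.Nat.DivMod using (m/n*n≡m)
import Data.Nat.Properties as ℕP
import Data.Nat.Tactic.RingSolver as ℕ-Solver
open import Data.Product using (proj₂)
open import Data.Rational as ℚ using (0ℚ; toℚᵘ)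
import Data.Rational.Properties as ℚP
open import Data.Rational.Solver using (module +-*-Solver)
open import Data.Rational.Unnormalised as ℚᵘ using (mkℚᵘ; *≡*; *≤*; *<*)
import Data.Rational.Unnormalised.Properties as ℚᵘP
open import Data.Sum using (_⊎_; inj₁; inj₂)
open import Data.Unit using (tt)
open import Relation.Binary.PropositionalEquality
  using (refl; sym; trans; cong; cong₂; subst; subst₂; module ≡-Reasoning)
open import Relation.Nullary.Decidable using (toWitness)

toℚᵘ-ℤ→ℚ : ∀ z → toℚᵘ (ℤ→ℚ z) ℚᵘ.≃ mkℚᵘ z 0
toℚᵘ-ℤ→ℚ z = ℚP.toℚᵘ-fromℚᵘ (mkℚᵘ z 0)

toℚᵘ-/ : ∀ z d → toℚᵘ (z / suc d) ℚᵘ.≃ mkℚᵘ z d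
toℚᵘ-/ z d = ℚP.toℚᵘ-fromℚᵘ (mkℚᵘ z d)

ℤ→ℚ-+ : ∀ a b → ℤ→ℚ (a ℤ.+ b) ≡ ℤ→ℚ a ℚ.+ ℤ→ℚ b
ℤ→ℚ-+ a b = ℚP.toℚᵘ-injective (begin
  toℚᵘ (ℤ→ℚ (a ℤ.+ b))          ≈⟨ toℚᵘ-ℤ→ℚ _ ⟩
  mkℚᵘ (a ℤ.+ b) 0               ≈⟨ *≡* (denominators a b) ⟩
  mkℚᵘ a 0 ℚᵘ.+ mkℚᵘ b 0         ≈⟨ ℚᵘP.+-cong (toℚᵘ-ℤ→ℚ a) (toℚᵘ-ℤ→ℚ b) ⟨
  toℚᵘ (ℤ→ℚ a) ℚᵘ.+ toℚᵘ (ℤ→ℚ b) ≈⟨ ℚP.toℚᵘ-homo-+ (ℤ→ℚ a) (ℤ→ℚ b) ⟨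
  toℚᵘ (ℤ→ℚ a ℚ.+ ℤ→ℚ b)         ∎)
  where
  open ℚᵘP.≃-Reasoning
  denominators : ∀ a b → (a ℤ.+ b) ℤ.* + 1 ≡ (a ℤ.* + 1 ℤ.+ b ℤ.* + 1) ℤ.* + 1
  denominators = ℤ-Solver.solve-∀

ℤ→ℚ-* : ∀ a b → ℤ→ℚ (a ℤ.* b) ≡ ℤ→ℚ a ℚ.* ℤ→ℚ b
ℤ→ℚ-* a b = ℚP.toℚᵘ-injective (begin
  toℚᵘ (ℤ→ℚ (a ℤ.* b))          ≈⟨ toℚᵘ-ℤ→ℚ _ ⟩
  mkℚᵘ (a ℤ.* b) 0               ≈⟨ *≡* refl ⟩
  mkℚᵘ a 0 ℚᵘ.* mkℚᵘ b 0         ≈⟨ ℚᵘP.*-cong (toℚᵘ-ℤ→ℚ a) (toℚᵘ-ℤ→ℚ b) ⟨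
  toℚᵘ (ℤ→ℚ a) ℚᵘ.* toℚᵘ (ℤ→ℚ b) ≈⟨ ℚP.toℚᵘ-homo-* (ℤ→ℚ a) (ℤ→ℚ b) ⟨
  toℚᵘ (ℤ→ℚ a ℚ.* ℤ→ℚ b)         ∎)
  where open ℚᵘP.≃-Reasoning

ℤ→ℚ-neg : ∀ a → ℤ→ℚ (ℤ.- a) ≡ ℚ.- ℤ→ℚ a
ℤ→ℚ-neg a = ℚP.toℚᵘ-injective (begin
  toℚᵘ (ℤ→ℚ (ℤ.- a)) ≈⟨ toℚᵘ-ℤ→ℚ _ ⟩
  mkℚᵘ (ℤ.- a) 0      ≈⟨ *≡* refl ⟩
  ℚᵘ.- mkℚᵘ a 0       ≈⟨ ℚᵘP.-‿cong (toℚᵘ-ℤ→ℚ a) ⟨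
  ℚᵘ.- toℚᵘ (ℤ→ℚ a)   ≈⟨ ℚP.toℚᵘ-homo‿- (ℤ→ℚ a) ⟨
  toℚᵘ (ℚ.- ℤ→ℚ a)    ∎)
  where open ℚᵘP.≃-Reasoning

ℤ→ℚ-- : ∀ a b → ℤ→ℚ (a ℤ.- b) ≡ ℤ→ℚ a ℚ.- ℤ→ℚ b
ℤ→ℚ-- a b = trans (ℤ→ℚ-+ a (ℤ.- b)) (cong (ℤ→ℚ a ℚ.+_) (ℤ→ℚ-neg b))

ℤ→ℚ-mono-≤ : ∀ {a b} → a ℤ.≤ b → ℤ→ℚ a ℚ.≤ ℤ→ℚ b
ℤ→ℚ-mono-≤ {a} {b} a≤b = ℚP.toℚᵘ-cancel-≤
  (ℚᵘP.≤-respˡ-≃ (ℚᵘP.≃-sym (toℚᵘ-ℤ→ℚ a)) (ℚᵘP.≤-respʳ-≃ (ℚᵘP.≃-sym (toℚᵘ-ℤ→ℚ b))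
    (*≤* (subst₂ ℤ._≤_ (sym (ℤP.*-identityʳ a)) (sym (ℤP.*-identityʳ b)) a≤b))))

ℤ→ℚ-mono-< : ∀ {a b} → a ℤ.< b → ℤ→ℚ a ℚ.< ℤ→ℚ b
ℤ→ℚ-mono-< {a} {b} a<b = ℚP.toℚᵘ-cancel-<
  (ℚᵘP.<-respˡ-≃ (ℚᵘP.≃-sym (toℚᵘ-ℤ→ℚ a)) (ℚᵘP.<-respʳ-≃ (ℚᵘP.≃-sym (toℚᵘ-ℤ→ℚ b))
    (*<* (subst₂ ℤ._<_ (sym (ℤP.*-identityʳ a)) (sym (ℤP.*-identityʳ b)) a<b))))

z/[1+d]*[1+d]≡z : ∀ z d → (z / suc d) ℚ.* ℤ→ℚ (+ suc d) ≡ ℤ→ℚ z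
z/[1+d]*[1+d]≡z z d = ℚP.toℚᵘ-injective (begin
  toℚᵘ ((z / suc d) ℚ.* ℤ→ℚ (+ suc d))          ≈⟨ ℚP.toℚᵘ-homo-* (z / suc d) (ℤ→ℚ (+ suc d)) ⟩
  toℚᵘ (z / suc d) ℚᵘ.* toℚᵘ (ℤ→ℚ (+ suc d))    ≈⟨ ℚᵘP.*-cong (toℚᵘ-/ z d) (toℚᵘ-ℤ→ℚ _) ⟩
  mkℚᵘ z d ℚᵘ.* mkℚᵘ (+ suc d) 0                ≈⟨ *≡* cross ⟩
  mkℚᵘ z 0                                      ≈⟨ toℚᵘ-ℤ→ℚ z ⟨
  toℚᵘ (ℤ→ℚ z)                                  ∎)
  where
  open ℚᵘP.≃-Reasoning
  cross : (z ℤ.* + suc d) ℤ.* + 1 ≡ z ℤ.* + (suc d ℕ.* 1)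
  cross = trans (ℤP.*-identityʳ _) (cong (λ m → z ℤ.* + m) (sym (ℕP.*-identityʳ (suc d))))

-- The summands of lamSign and lamStd have the shape a s and a z/(1+d).
[as-az/d]*d≡a[sd-z] : ∀ a s z d →
  (ℤ→ℚ a ℚ.* ℤ→ℚ s ℚ.- ℤ→ℚ a ℚ.* (z / suc d)) ℚ.* ℤ→ℚ (+ suc d) ≡ ℤ→ℚ (a ℤ.* (s ℤ.* + suc d ℤ.- z))
[as-az/d]*d≡a[sd-z] a s z d = begin
  (A ℚ.* S ℚ.- A ℚ.* (z / suc d)) ℚ.* D     ≡⟨ distrib A S (z / suc d) D ⟩
  A ℚ.* (S ℚ.* D ℚ.- (z / suc d) ℚ.* D)     ≡⟨ cong (λ u → A ℚ.* (S ℚ.* D ℚ.- u)) (z/[1+d]*[1+d]≡z z d) ⟩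
  A ℚ.* (S ℚ.* D ℚ.- ℤ→ℚ z)                 ≡⟨ cong (λ u → A ℚ.* (u ℚ.- ℤ→ℚ z)) (ℤ→ℚ-* s (+ suc d)) ⟨
  A ℚ.* (ℤ→ℚ (s ℤ.* + suc d) ℚ.- ℤ→ℚ z)     ≡⟨ cong (A ℚ.*_) (ℤ→ℚ-- (s ℤ.* + suc d) z) ⟨
  A ℚ.* ℤ→ℚ (s ℤ.* + suc d ℤ.- z)           ≡⟨ ℤ→ℚ-* a (s ℤ.* + suc d ℤ.- z) ⟨
  ℤ→ℚ (a ℤ.* (s ℤ.* + suc d ℤ.- z))         ∎
  where
  open ≡-Reasoning
  A = ℤ→ℚ a
  S = ℤ→ℚ s
  D = ℤ→ℚ (+ suc d)
  distrib : ∀ (a s w d : ℚ) → (a ℚ.* s ℚ.- a ℚ.* w) ℚ.* d ≡ a ℚ.* (s ℚ.* d ℚ.- w ℚ.* d)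
  distrib = solve 4 (λ a s w d → (a :* s :- a :* w) :* d := a :* (s :* d :- w :* d)) refl
    where open +-*-Solver

sumℤ : ℕ → ℕ → (ℕ → ℤ) → ℤ
sumℤ a zero      f = 0ℤ
sumℤ a (suc len) f = f a ℤ.+ sumℤ (suc a) len f

sumFrom-cong : ∀ a len {f g} → (∀ k → f k ≡ g k) → sumFrom a len f ≡ sumFrom a len g
sumFrom-cong a zero      f≗g = refl
sumFrom-cong a (suc len) f≗g = cong₂ ℚ._+_ (f≗g a) (sumFrom-cong (suc a) len f≗g)

sumFrom-sub : ∀ a len f g → sumFrom a len f ℚ.- sumFrom a len g ≡ sumFrom a len (λ k → f k ℚ.- g k)
sumFrom-sub a zero      f g = refl
sumFrom-sub a (suc len) f g =
  trans (interchange (f a) _ (g a) _) (cong (f a ℚ.- g a ℚ.+_) (sumFrom-sub (suc a) len f g))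
  where
  interchange : ∀ (x y z w : ℚ) → (x ℚ.+ y) ℚ.- (z ℚ.+ w) ≡ (x ℚ.- z) ℚ.+ (y ℚ.- w)
  interchange = solve 4 (λ x y z w → (x :+ y) :- (z :+ w) := (x :- z) :+ (y :- w)) refl
    where open +-*-Solver

sumFrom-*ʳ : ∀ a len f q → sumFrom a len f ℚ.* q ≡ sumFrom a len (λ k → f k ℚ.* q)
sumFrom-*ʳ a zero      f q = ℚP.*-zeroˡ q
sumFrom-*ʳ a (suc len) f q =
  trans (ℚP.*-distribʳ-+ q (f a) _) (cong (f a ℚ.* q ℚ.+_) (sumFrom-*ʳ (suc a) len f q))

ℤ→ℚ-sumℤ : ∀ a len f → ℤ→ℚ (sumℤ a len f) ≡ sumFrom a len (λ k → ℤ→ℚ (f k))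
ℤ→ℚ-sumℤ a zero      f = refl
ℤ→ℚ-sumℤ a (suc len) f = trans (ℤ→ℚ-+ (f a) _) (cong (ℤ→ℚ (f a) ℚ.+_) (ℤ→ℚ-sumℤ (suc a) len f))

sumℤ-snoc : ∀ a len f → sumℤ a (suc len) f ≡ sumℤ a len f ℤ.+ f (a ℕ.+ len)
sumℤ-snoc a zero      f = trans (ℤP.+-identityʳ (f a)) (trans (cong f (sym (ℕP.+-identityʳ a))) (sym (ℤP.+-identityˡ _)))
sumℤ-snoc a (suc len) f = begin
  f a ℤ.+ sumℤ (suc a) (suc len) f                   ≡⟨ cong (λ s → f a ℤ.+ s) (sumℤ-snoc (suc a) len f) ⟩
  f a ℤ.+ (sumℤ (suc a) len f ℤ.+ f (suc a ℕ.+ len)) ≡⟨ ℤP.+-assoc (f a) _ _ ⟨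
  f a ℤ.+ sumℤ (suc a) len f ℤ.+ f (suc a ℕ.+ len)   ≡⟨ cong (λ k → f a ℤ.+ sumℤ (suc a) len f ℤ.+ f k) (ℕP.+-suc a len) ⟨
  f a ℤ.+ sumℤ (suc a) len f ℤ.+ f (a ℕ.+ suc len)   ∎
  where open ≡-Reasoning

sumℤ-mono-≤ : ∀ a len {f g} → (∀ k → f k ℤ.≤ g k) → sumℤ a len f ℤ.≤ sumℤ a len g
sumℤ-mono-≤ a zero      f≤g = ℤP.≤-refl
sumℤ-mono-≤ a (suc len) f≤g = ℤP.+-mono-≤ (f≤g a) (sumℤ-mono-≤ (suc a) len f≤g)

-- Counting k-cycles

cycleCount : ℕ → ℕ → ℕ
cycleCount n k = (n C k) ℕ.* (k ∸ 1) !

nCk*k!*[n∸k]!≡n! : ∀ {n k} → k ≤ n → (n C k) ℕ.* (k ! ℕ.* (n ∸ k) !) ≡ n !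
nCk*k!*[n∸k]!≡n! {n} {k} k≤n = trans (cong (ℕ._* (k ! ℕ.* (n ∸ k) !)) (nCk≡n!/k![n-k]! k≤n))
                                     (m/n*n≡m {{k ℕP.!* (n ∸ k) !≢0}} (k![n∸k]!∣n! k≤n))

cycleCount*k*[n∸k]!≡n! : ∀ {n k} → suc k ≤ n → cycleCount n (suc k) ℕ.* suc k ℕ.* (n ∸ suc k) ! ≡ n !
cycleCount*k*[n∸k]!≡n! {n} {k} k<n = trans (regroup (n C suc k) (k !) k ((n ∸ suc k) !)) (nCk*k!*[n∸k]!≡n! k<n)
  where
  regroup : ∀ c f k r → c ℕ.* f ℕ.* suc k ℕ.* r ≡ c ℕ.* ((f ℕ.+ k ℕ.* f) ℕ.* r)
  regroup = ℕ-Solver.solve-∀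

cycleCount*k*j!≡[j+k]! : ∀ j k → cycleCount (j ℕ.+ suc k) (suc k) ℕ.* suc k ℕ.* j ! ≡ (j ℕ.+ suc k) !
cycleCount*k*j!≡[j+k]! j k = subst (λ i → cycleCount (j ℕ.+ suc k) (suc k) ℕ.* suc k ℕ.* i ! ≡ (j ℕ.+ suc k) !)
  (ℕP.m+n∸n≡m j (suc k)) (cycleCount*k*[n∸k]!≡n! (ℕP.m≤n+m (suc k) j))

cycleCount-recurrence : ∀ {n k} → 2 ℕ.+ k ≤ n →
  cycleCount n (suc k) ℕ.* suc k ℕ.* (n ∸ suc k) ≡ cycleCount n (2 ℕ.+ k) ℕ.* (2 ℕ.+ k)
cycleCount-recurrence {n} {k} k+2≤n = ℕP.*-cancelʳ-≡ _ _ ((n ∸ (2 ℕ.+ k)) !) {{(n ∸ (2 ℕ.+ k)) ℕP.!≢0}} (begin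
  T₁ ℕ.* suc k ℕ.* (n ∸ suc k) ℕ.* (n ∸ (2 ℕ.+ k)) !   ≡⟨ ℕP.*-assoc (T₁ ℕ.* suc k) _ _ ⟩
  T₁ ℕ.* suc k ℕ.* ((n ∸ suc k) ℕ.* (n ∸ (2 ℕ.+ k)) !) ≡⟨ cong (T₁ ℕ.* suc k ℕ.*_) ([n-k]*[n-k-1]!≡[n-k]! k+2≤n) ⟩
  T₁ ℕ.* suc k ℕ.* (n ∸ suc k) !                     ≡⟨ cycleCount*k*[n∸k]!≡n! (ℕP.<⇒≤ k+2≤n) ⟩
  n !                                                ≡⟨ cycleCount*k*[n∸k]!≡n! k+2≤n ⟨
  T₂ ℕ.* (2 ℕ.+ k) ℕ.* (n ∸ (2 ℕ.+ k)) !               ∎)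
  where
  open ≡-Reasoning
  T₁ = cycleCount n (suc k)
  T₂ = cycleCount n (2 ℕ.+ k)

-- Consecutive cycle counts grow at least by the factor (n - k - 1)(k + 1)/(k + 2) ≥ 5/2.
cycleCount-ratio : ∀ {n k} → 6 ℕ.+ k ≤ n → 5 ℕ.* cycleCount n (suc k) ≤ 2 ℕ.* cycleCount n (2 ℕ.+ k)
cycleCount-ratio {n} {k} k+6≤n = ℕP.*-cancelʳ-≤ _ _ (suc k) (begin
  5 ℕ.* T₁ ℕ.* suc k                 ≡⟨ swap 5 T₁ (suc k) ⟩
  T₁ ℕ.* suc k ℕ.* 5                 ≤⟨ ℕP.*-monoʳ-≤ (T₁ ℕ.* suc k) 5≤n∸[k+1] ⟩
  T₁ ℕ.* suc k ℕ.* (n ∸ suc k)       ≡⟨ cycleCount-recurrence (ℕP.≤-trans (ℕP.m≤n+m _ 4) k+6≤n) ⟩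
  T₂ ℕ.* (2 ℕ.+ k)                   ≤⟨ ℕP.*-monoʳ-≤ T₂ (ℕP.m≤m+n (2 ℕ.+ k) k) ⟩
  T₂ ℕ.* (2 ℕ.+ k ℕ.+ k)             ≡⟨ double T₂ k ⟩
  2 ℕ.* T₂ ℕ.* suc k                 ∎)
  where
  open ℕP.≤-Reasoning
  T₁ = cycleCount n (suc k)
  T₂ = cycleCount n (2 ℕ.+ k)
  5≤n∸[k+1] : 5 ≤ n ∸ suc k
  5≤n∸[k+1] = subst (_≤ n ∸ suc k) (ℕP.m+n∸n≡m 5 (suc k)) (ℕP.∸-monoˡ-≤ (suc k) k+6≤n)
  swap : ∀ a b c → a ℕ.* b ℕ.* c ≡ b ℕ.* c ℕ.* a
  swap = ℕ-Solver.solve-∀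
  double : ∀ t k → t ℕ.* (2 ℕ.+ k ℕ.+ k) ≡ 2 ℕ.* t ℕ.* suc k
  double = ℕ-Solver.solve-∀

-- The eigenvalue difference as an integer sum over cycle types

signℤ-±1 : ∀ m → signℤ m ≡ + 1 ⊎ signℤ m ≡ ℤ.- + 1
signℤ-±1 zero          = inj₁ refl
signℤ-±1 (suc zero)    = inj₂ refl
signℤ-±1 (suc (suc m)) = signℤ-±1 m

signℤ-suc : ∀ m → signℤ (suc m) ≡ ℤ.- signℤ m
signℤ-suc zero          = refl
signℤ-suc (suc zero)    = refl
signℤ-suc (suc (suc m)) = signℤ-suc m

signℤ-odd : ∀ j → signℤ (suc (j ℕ.* 2)) ≡ ℤ.- + 1
signℤ-odd zero    = refl
signℤ-odd (suc j) = signℤ-odd j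

-- (n - 1)(χ_{(1^n)}(σ) - χ_{(n-1,1)}(σ)/(n - 1)) for a k-cycle σ, whose standard character is n - k - 1.
charGap : ℕ → ℕ → ℤ
charGap n k = signℤ (k ∸ 1) ℤ.* + (n ∸ 1) ℤ.- ((+ n) ℤ.- (+ k) ℤ.- (+ 1))

classGap : ℕ → ℕ → ℤ
classGap n k = + cycleCount n k ℤ.* charGap n k

lamSign-lamStd-scaled : ∀ d (I : ℕ → Bool) →
  (lamSign (2 ℕ.+ d) I ℚ.- lamStd (2 ℕ.+ d) I) ℚ.* ℤ→ℚ (+ suc d)
    ≡ ℤ→ℚ (sumℤ 2 (suc d) (λ k → if I k then classGap (2 ℕ.+ d) k else 0ℤ))
lamSign-lamStd-scaled d I = begin
  (sumFrom 2 (suc d) f ℚ.- sumFrom 2 (suc d) g) ℚ.* q  ≡⟨ cong (ℚ._* q) (sumFrom-sub 2 (suc d) f g) ⟩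
  sumFrom 2 (suc d) (λ k → f k ℚ.- g k) ℚ.* q          ≡⟨ sumFrom-*ʳ 2 (suc d) (λ k → f k ℚ.- g k) q ⟩
  sumFrom 2 (suc d) (λ k → (f k ℚ.- g k) ℚ.* q)        ≡⟨ sumFrom-cong 2 (suc d) summand ⟩
  sumFrom 2 (suc d) (λ k → ℤ→ℚ (selected k))           ≡⟨ ℤ→ℚ-sumℤ 2 (suc d) selected ⟨
  ℤ→ℚ (sumℤ 2 (suc d) selected)                        ∎
  where
  open ≡-Reasoning
  n = 2 ℕ.+ d
  q = ℤ→ℚ (+ suc d)
  a : ℕ → ℚ
  a k = ℕ→ℚ (cycleCount n k)
  f g : ℕ → ℚ
  f k = if I k then a k ℚ.* ℤ→ℚ (signℤ (k ∸ 1)) else 0ℚ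
  g k = if I k then a k ℚ.* div ((+ n) ℤ.- (+ k) ℤ.- (+ 1)) (n ∸ 1) else 0ℚ
  selected : ℕ → ℤ
  selected k = if I k then classGap n k else 0ℤ
  summand : ∀ k → (f k ℚ.- g k) ℚ.* q ≡ ℤ→ℚ (selected k)
  summand k with I k
  ... | true  = [as-az/d]*d≡a[sd-z] (+ cycleCount n k) (signℤ (k ∸ 1)) _ d
  ... | false = ℚP.*-zeroˡ q

-- Bounding the integer sum from below

negClassGap : ℕ → ℕ → ℤ
negClassGap n k = + cycleCount n k ℤ.* (charGap n k ⊓ 0ℤ)

-- Only k = n - 1 is kept exactly: negative summands below it are all counted, positive ones dropped.
lowerSum : ℕ → ℤ
lowerSum n = sumℤ 2 (n ∸ 3) (negClassGap n) ℤ.+ classGap n (n ∸ 1)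

negClassGap≤select : ∀ n k (b : Bool) → negClassGap n k ℤ.≤ (if b then classGap n k else 0ℤ)
negClassGap≤select n k true  = ℤP.*-monoˡ-≤-nonNeg (+ cycleCount n k) (ℤP.i⊓j≤i (charGap n k) 0ℤ)
negClassGap≤select n k false = ℤP.≤-trans
  (ℤP.*-monoˡ-≤-nonNeg (+ cycleCount n k) (ℤP.i⊓j≤j (charGap n k) 0ℤ))
  (ℤP.≤-reflexive (ℤP.*-zeroʳ (+ cycleCount n k)))

lowerSum≤selectedSum : ∀ m (I : ℕ → Bool) → I (2 ℕ.+ m) ≡ true → (∀ k → I k ≡ true → 2 ≤ k × k ≤ 2 ℕ.+ m) →
  lowerSum (3 ℕ.+ m) ℤ.≤ sumℤ 2 (2 ℕ.+ m) (λ k → if I k then classGap (3 ℕ.+ m) k else 0ℤ)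
lowerSum≤selectedSum m I top∈I I⊆ = begin
  sumℤ 2 m (negClassGap n) ℤ.+ classGap n (2 ℕ.+ m)
    ≤⟨ ℤP.+-monoˡ-≤ _ (sumℤ-mono-≤ 2 m (λ k → negClassGap≤select n k (I k))) ⟩
  sumℤ 2 m selected ℤ.+ classGap n (2 ℕ.+ m)
    ≡⟨ cong (λ b → sumℤ 2 m selected ℤ.+ (if b then classGap n (2 ℕ.+ m) else 0ℤ)) top∈I ⟨
  sumℤ 2 m selected ℤ.+ selected (2 ℕ.+ m)
    ≡⟨ ℤP.+-identityʳ _ ⟨
  sumℤ 2 m selected ℤ.+ selected (2 ℕ.+ m) ℤ.+ 0ℤ
    ≡⟨ cong (λ b → sumℤ 2 m selected ℤ.+ selected (2 ℕ.+ m) ℤ.+ (if b then classGap n n else 0ℤ)) n∉I ⟨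
  sumℤ 2 m selected ℤ.+ selected (2 ℕ.+ m) ℤ.+ selected n
    ≡⟨ cong (ℤ._+ selected n) (sumℤ-snoc 2 m selected) ⟨
  sumℤ 2 (suc m) selected ℤ.+ selected n
    ≡⟨ sumℤ-snoc 2 (suc m) selected ⟨
  sumℤ 2 (2 ℕ.+ m) selected ∎
  where
  open ℤP.≤-Reasoning
  n = 3 ℕ.+ m
  selected : ℕ → ℤ
  selected k = if I k then classGap n k else 0ℤ
  n∉I : I n ≡ false
  n∉I with I n in n∈I
  ... | true  = ⊥-elim (ℕP.1+n≰n (proj₂ (I⊆ n n∈I)))
  ... | false = refl

charGap-suc : ∀ d k → charGap (suc d) k ≡ signℤ (k ∸ 1) ℤ.* + d ℤ.+ (+ k ℤ.- + d)
charGap-suc d k = rearrange (signℤ (k ∸ 1)) (+ d) (+ k)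
  where
  rearrange : ∀ s d k → s ℤ.* d ℤ.- ((+ 1 ℤ.+ d) ℤ.- k ℤ.- + 1) ≡ s ℤ.* d ℤ.+ (k ℤ.- d)
  rearrange = ℤ-Solver.solve-∀

charGap-lower : ∀ d k → ℤ.- (+ d ℤ.+ + d) ℤ.≤ charGap (suc d) k
charGap-lower d k = begin
  ℤ.- (+ d ℤ.+ + d)                          ≡⟨ ℤP.neg-distrib-+ (+ d) (+ d) ⟩
  ℤ.- + d ℤ.+ ℤ.- + d                        ≤⟨ ℤP.+-mono-≤ sign-lower k-lower ⟩
  signℤ (k ∸ 1) ℤ.* + d ℤ.+ (+ k ℤ.- + d)    ≡⟨ charGap-suc d k ⟨
  charGap (suc d) k                          ∎
  where
  open ℤP.≤-Reasoning
  k-lower : ℤ.- + d ℤ.≤ + k ℤ.- + d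
  k-lower = subst (ℤ._≤ + k ℤ.- + d) (ℤP.+-identityˡ (ℤ.- + d)) (ℤP.+-monoˡ-≤ (ℤ.- + d) (+≤+ z≤n))
  sign-lower : ℤ.- + d ℤ.≤ signℤ (k ∸ 1) ℤ.* + d
  sign-lower with signℤ-±1 (k ∸ 1)
  ... | inj₁ s≡1  rewrite s≡1 = ℤP.≤-trans ℤP.neg-≤-pos (ℤP.≤-reflexive (sym (ℤP.*-identityˡ (+ d))))
  ... | inj₂ s≡-1 rewrite s≡-1 = ℤP.≤-reflexive (sym (ℤP.-1*i≡-i (+ d)))

0≤i*j : ∀ i .{{_ : ℤ.NonNegative i}} {j} → 0ℤ ℤ.≤ j → 0ℤ ℤ.≤ i ℤ.* j
0≤i*j i {j} 0≤j = subst (ℤ._≤ i ℤ.* j) (ℤP.*-zeroʳ i) (ℤP.*-monoˡ-≤-nonNeg i 0≤j)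

negClassGap-lower : ∀ d k → 0ℤ ℤ.≤ negClassGap (suc d) k ℤ.+ (+ d ℤ.+ + d) ℤ.* + cycleCount (suc d) k
negClassGap-lower d k = begin
  0ℤ                                         ≡⟨ cancel (+ T) (+ d ℤ.+ + d) ⟨
  + T ℤ.* ℤ.- (+ d ℤ.+ + d) ℤ.+ (+ d ℤ.+ + d) ℤ.* + T
    ≤⟨ ℤP.+-monoˡ-≤ _ (ℤP.*-monoˡ-≤-nonNeg (+ T) (ℤP.⊓-glb (charGap-lower d k) ℤP.neg-≤-pos)) ⟩
  negClassGap (suc d) k ℤ.+ (+ d ℤ.+ + d) ℤ.* + T ∎
  where
  open ℤP.≤-Reasoning
  T = cycleCount (suc d) k
  cancel : ∀ t e → t ℤ.* ℤ.- e ℤ.+ e ℤ.* t ≡ 0ℤ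
  cancel = ℤ-Solver.solve-∀

-- Telescoping with cycleCount-ratio: the 10 d T_{L+1} in the bound absorbs the next summand.
negClassGap-sum-lower : ∀ d L → 5 ℕ.+ L ≤ suc d →
  0ℤ ℤ.≤ + 3 ℤ.* sumℤ 2 L (negClassGap (suc d)) ℤ.+ + d ℤ.* (+ 10 ℤ.* + cycleCount (suc d) (suc L))
negClassGap-sum-lower d zero    _      =
  subst (0ℤ ℤ.≤_) (sym (ℤP.+-identityˡ _)) (0≤i*j (+ d) (0≤i*j (+ 10) {+ cycleCount (suc d) 1} (+≤+ z≤n)))
negClassGap-sum-lower d (suc L) L+6≤n =
  subst (λ σ → 0ℤ ℤ.≤ + 3 ℤ.* σ ℤ.+ + d ℤ.* (+ 10 ℤ.* + T₂)) (sym (sumℤ-snoc 2 L (negClassGap n))) (begin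
    0ℤ
      ≤⟨ ℤP.+-mono-≤ (ℤP.+-mono-≤ previous (0≤i*j (+ 3) (negClassGap-lower d (2 ℕ.+ L)))) gain ⟩
    (+ 3 ℤ.* Σ ℤ.+ + d ℤ.* (+ 10 ℤ.* + T₁)) ℤ.+ + 3 ℤ.* (P ℤ.+ (+ d ℤ.+ + d) ℤ.* + T₂)
      ℤ.+ (+ d ℤ.+ + d) ℤ.* (+ 2 ℤ.* + T₂ ℤ.- + 5 ℤ.* + T₁)
      ≡⟨ rearrange Σ P (+ T₁) (+ T₂) (+ d) ⟩
    + 3 ℤ.* (Σ ℤ.+ P) ℤ.+ + d ℤ.* (+ 10 ℤ.* + T₂) ∎)
  where
  open ℤP.≤-Reasoning
  n = suc d
  Σ = sumℤ 2 L (negClassGap n)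
  P = negClassGap n (2 ℕ.+ L)
  T₁ = cycleCount n (suc L)
  T₂ = cycleCount n (2 ℕ.+ L)
  previous = negClassGap-sum-lower d L (ℕP.≤-trans (ℕP.n≤1+n _) L+6≤n)
  ratio : + 5 ℤ.* + T₁ ℤ.≤ + 2 ℤ.* + T₂
  ratio = subst₂ ℤ._≤_ (ℤP.pos-* 5 T₁) (ℤP.pos-* 2 T₂) (+≤+ (cycleCount-ratio L+6≤n))
  gain : 0ℤ ℤ.≤ (+ d ℤ.+ + d) ℤ.* (+ 2 ℤ.* + T₂ ℤ.- + 5 ℤ.* + T₁)
  gain = 0≤i*j (+ d ℤ.+ + d) (ℤP.i≤j⇒0≤j-i ratio)
  rearrange : ∀ Σ P t₁ t₂ d →
    (+ 3 ℤ.* Σ ℤ.+ d ℤ.* (+ 10 ℤ.* t₁)) ℤ.+ + 3 ℤ.* (P ℤ.+ (d ℤ.+ d) ℤ.* t₂) ℤ.+ (d ℤ.+ d) ℤ.* (+ 2 ℤ.* t₂ ℤ.- + 5 ℤ.* t₁)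
      ≡ + 3 ℤ.* (Σ ℤ.+ P) ℤ.+ d ℤ.* (+ 10 ℤ.* t₂)
  rearrange = ℤ-Solver.solve-∀

target : ℕ → ℕ
target n = n ℕ.* (n ∸ 5) ℕ.* (n ∸ 3) ! ℕ.* (n ∸ 1)

-- With n = 5 + m, multiplying by 24 (n - 4) (n - 2) and dividing by n! leaves the quadratic
-- inequality P m < Q m, whose margin 2m² - 22m - 84 is positive from m = 15 (n = 20) on.
tail-bound : ∀ m → 15 ≤ m →
  target (5 ℕ.+ m) ℕ.+ (4 ℕ.+ m) ℕ.* (10 ℕ.* cycleCount (5 ℕ.+ m) (1 ℕ.+ m))
    ℕ.+ 3 ℕ.* (cycleCount (5 ℕ.+ m) (3 ℕ.+ m) ℕ.* (5 ℕ.+ m))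
  ℕ.< 3 ℕ.* (cycleCount (5 ℕ.+ m) (4 ℕ.+ m) ℕ.* (4 ℕ.+ m))
tail-bound m 15≤m = ℕP.*-cancelʳ-< M _ _ (begin-strict
  (target n ℕ.+ (4 ℕ.+ m) ℕ.* (10 ℕ.* T₄) ℕ.+ 3 ℕ.* (T₂ ℕ.* n)) ℕ.* M
    ≡⟨ expand m ((2 ℕ.+ m) !) T₄ T₂ ⟩
  24 ℕ.* (1 ℕ.+ m) ℕ.* m ℕ.* n ! ℕ.+ 10 ℕ.* (4 ℕ.+ m) ℕ.* (3 ℕ.+ m) ℕ.* (T₄ ℕ.* (1 ℕ.+ m) ℕ.* 4 !)
    ℕ.+ 36 ℕ.* (1 ℕ.+ m) ℕ.* n ℕ.* (T₂ ℕ.* (3 ℕ.+ m) ℕ.* 2 !)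
    ≡⟨ cong₂ (λ x y → 24 ℕ.* (1 ℕ.+ m) ℕ.* m ℕ.* n ! ℕ.+ 10 ℕ.* (4 ℕ.+ m) ℕ.* (3 ℕ.+ m) ℕ.* x
                      ℕ.+ 36 ℕ.* (1 ℕ.+ m) ℕ.* n ℕ.* y)
             (cycleCount*k*j!≡[j+k]! 4 m) (cycleCount*k*j!≡[j+k]! 2 (2 ℕ.+ m)) ⟩
  24 ℕ.* (1 ℕ.+ m) ℕ.* m ℕ.* n ! ℕ.+ 10 ℕ.* (4 ℕ.+ m) ℕ.* (3 ℕ.+ m) ℕ.* n ! ℕ.+ 36 ℕ.* (1 ℕ.+ m) ℕ.* n ℕ.* n !
    ≡⟨ collect m (n !) ⟩
  P m ℕ.* n !
    <⟨ ℕP.*-monoˡ-< (n !) {{n ℕP.!≢0}} P<Q ⟩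
  Q m ℕ.* n !
    ≡⟨ cong (Q m ℕ.*_) (cycleCount*k*j!≡[j+k]! 1 (3 ℕ.+ m)) ⟨
  Q m ℕ.* (T₁ ℕ.* (4 ℕ.+ m) ℕ.* 1 !)
    ≡⟨ regroup m T₁ ⟩
  3 ℕ.* (T₁ ℕ.* (4 ℕ.+ m)) ℕ.* M ∎)
  where
  open ℕP.≤-Reasoning
  n = 5 ℕ.+ m
  M = 24 ℕ.* (1 ℕ.+ m) ℕ.* (3 ℕ.+ m)
  T₁ = cycleCount n (4 ℕ.+ m)
  T₂ = cycleCount n (3 ℕ.+ m)
  T₄ = cycleCount n (1 ℕ.+ m)
  P Q : ℕ → ℕ
  P m = 24 ℕ.* (1 ℕ.+ m) ℕ.* m ℕ.+ 10 ℕ.* (4 ℕ.+ m) ℕ.* (3 ℕ.+ m) ℕ.+ 36 ℕ.* (1 ℕ.+ m) ℕ.* (5 ℕ.+ m)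
  Q m = 72 ℕ.* (1 ℕ.+ m) ℕ.* (3 ℕ.+ m)
  margin : ∀ r → 72 ℕ.* (1 ℕ.+ (15 ℕ.+ r)) ℕ.* (3 ℕ.+ (15 ℕ.+ r))
    ≡ 24 ℕ.* (1 ℕ.+ (15 ℕ.+ r)) ℕ.* (15 ℕ.+ r) ℕ.+ 10 ℕ.* (4 ℕ.+ (15 ℕ.+ r)) ℕ.* (3 ℕ.+ (15 ℕ.+ r))
      ℕ.+ 36 ℕ.* (1 ℕ.+ (15 ℕ.+ r)) ℕ.* (5 ℕ.+ (15 ℕ.+ r)) ℕ.+ suc (35 ℕ.+ 38 ℕ.* r ℕ.+ 2 ℕ.* (r ℕ.* r))
  margin = ℕ-Solver.solve-∀
  P<Q : P m ℕ.< Q m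
  P<Q = subst (λ m → P m ℕ.< Q m) (ℕP.m+[n∸m]≡n 15≤m)
          (subst (P (15 ℕ.+ (m ∸ 15)) ℕ.<_) (sym (margin (m ∸ 15))) (ℕP.m<m+n _ (s≤s z≤n)))
  expand : ∀ m G t₄ t₂ →
    ((5 ℕ.+ m) ℕ.* m ℕ.* G ℕ.* (4 ℕ.+ m) ℕ.+ (4 ℕ.+ m) ℕ.* (10 ℕ.* t₄) ℕ.+ 3 ℕ.* (t₂ ℕ.* (5 ℕ.+ m)))
      ℕ.* (24 ℕ.* (1 ℕ.+ m) ℕ.* (3 ℕ.+ m))
    ≡ 24 ℕ.* (1 ℕ.+ m) ℕ.* m ℕ.* ((5 ℕ.+ m) ℕ.* ((4 ℕ.+ m) ℕ.* ((3 ℕ.+ m) ℕ.* G)))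
      ℕ.+ 10 ℕ.* (4 ℕ.+ m) ℕ.* (3 ℕ.+ m) ℕ.* (t₄ ℕ.* (1 ℕ.+ m) ℕ.* 24)
      ℕ.+ 36 ℕ.* (1 ℕ.+ m) ℕ.* (5 ℕ.+ m) ℕ.* (t₂ ℕ.* (3 ℕ.+ m) ℕ.* 2)
  expand = ℕ-Solver.solve-∀
  collect : ∀ m F → 24 ℕ.* (1 ℕ.+ m) ℕ.* m ℕ.* F ℕ.+ 10 ℕ.* (4 ℕ.+ m) ℕ.* (3 ℕ.+ m) ℕ.* F
      ℕ.+ 36 ℕ.* (1 ℕ.+ m) ℕ.* (5 ℕ.+ m) ℕ.* F
    ≡ (24 ℕ.* (1 ℕ.+ m) ℕ.* m ℕ.+ 10 ℕ.* (4 ℕ.+ m) ℕ.* (3 ℕ.+ m) ℕ.+ 36 ℕ.* (1 ℕ.+ m) ℕ.* (5 ℕ.+ m)) ℕ.* F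
  collect = ℕ-Solver.solve-∀
  regroup : ∀ m t → 72 ℕ.* (1 ℕ.+ m) ℕ.* (3 ℕ.+ m) ℕ.* (t ℕ.* (4 ℕ.+ m) ℕ.* 1)
    ≡ 3 ℕ.* (t ℕ.* (4 ℕ.+ m)) ℕ.* (24 ℕ.* (1 ℕ.+ m) ℕ.* (3 ℕ.+ m))
  regroup = ℕ-Solver.solve-∀

<-3*[s+z-b+c] : ∀ {s z : ℤ} {t a b c : ℕ} → 0ℤ ℤ.≤ + 3 ℤ.* s ℤ.+ + a → 0ℤ ℤ.≤ z →
  t ℕ.+ a ℕ.+ 3 ℕ.* b ℕ.< 3 ℕ.* c → + t ℤ.< + 3 ℤ.* (s ℤ.+ z ℤ.+ ℤ.- + b ℤ.+ + c)
<-3*[s+z-b+c] {s} {z} {t} {a} {b} {c} 0≤3s+a 0≤z t+a+3b<3c = begin-strict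
  + t                                                  ≡⟨ split (+ t) (+ a) (+ b) ⟩
  (+ t ℤ.+ + a ℤ.+ + 3 ℤ.* + b) ℤ.- (+ a ℤ.+ + 3 ℤ.* + b) <⟨ ℤP.+-monoˡ-< _ lifted ⟩
  + 3 ℤ.* + c ℤ.- (+ a ℤ.+ + 3 ℤ.* + b)                 ≤⟨ x≤y+x (ℤP.+-mono-≤ 0≤3s+a (0≤i*j (+ 3) 0≤z)) ⟩
  (+ 3 ℤ.* s ℤ.+ + a ℤ.+ + 3 ℤ.* z) ℤ.+ (+ 3 ℤ.* + c ℤ.- (+ a ℤ.+ + 3 ℤ.* + b))
                                                       ≡⟨ collect s z (+ a) (+ b) (+ c) ⟩
  + 3 ℤ.* (s ℤ.+ z ℤ.+ ℤ.- + b ℤ.+ + c)                ∎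
  where
  open ℤP.≤-Reasoning
  x≤y+x : ∀ {x y} → 0ℤ ℤ.≤ y → x ℤ.≤ y ℤ.+ x
  x≤y+x {x} {y} 0≤y = subst (ℤ._≤ y ℤ.+ x) (ℤP.+-identityˡ x) (ℤP.+-monoˡ-≤ x 0≤y)
  lifted : + t ℤ.+ + a ℤ.+ + 3 ℤ.* + b ℤ.< + 3 ℤ.* + c
  lifted = subst₂ ℤ._<_ (cong (λ x → + t ℤ.+ + a ℤ.+ x) (ℤP.pos-* 3 b)) (ℤP.pos-* 3 c) (+<+ t+a+3b<3c)
  split : ∀ t a b → t ≡ (t ℤ.+ a ℤ.+ + 3 ℤ.* b) ℤ.- (a ℤ.+ + 3 ℤ.* b)
  split = ℤ-Solver.solve-∀
  collect : ∀ s z a b c → (+ 3 ℤ.* s ℤ.+ a ℤ.+ + 3 ℤ.* z) ℤ.+ (+ 3 ℤ.* c ℤ.- (a ℤ.+ + 3 ℤ.* b))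
    ≡ + 3 ℤ.* (s ℤ.+ z ℤ.+ ℤ.- b ℤ.+ c)
  collect = ℤ-Solver.solve-∀

charGap-even : ∀ d k → signℤ (k ∸ 1) ≡ + 1 → charGap (suc d) k ≡ + k
charGap-even d k s≡1 =
  trans (charGap-suc d k) (trans (cong (λ s → s ℤ.* + d ℤ.+ (+ k ℤ.- + d)) s≡1) (simplify (+ d) (+ k)))
  where
  simplify : ∀ d k → + 1 ℤ.* d ℤ.+ (k ℤ.- d) ≡ k
  simplify = ℤ-Solver.solve-∀

charGap-odd : ∀ d k → signℤ (k ∸ 1) ≡ ℤ.- + 1 → charGap (suc d) k ≡ + k ℤ.- (+ d ℤ.+ + d)
charGap-odd d k s≡-1 =
  trans (charGap-suc d k) (trans (cong (λ s → s ℤ.* + d ℤ.+ (+ k ℤ.- + d)) s≡-1) (simplify (+ d) (+ k)))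
  where
  simplify : ∀ d k → ℤ.- + 1 ℤ.* d ℤ.+ (k ℤ.- d) ≡ k ℤ.- (d ℤ.+ d)
  simplify = ℤ-Solver.solve-∀

-- For even n the classes n - 3, n - 2, n - 1 contribute 0, -n T_{n-2} and (n - 1) T_{n-1}.
-- Stated for a variable m: checking conversions that unfold (20 + r)! at a literal offset is
-- prohibitively expensive, so the instance m = 15 + 2j is only reached through subst below.
target<3*lowerSum-from20 : ∀ m → 15 ≤ m → signℤ m ≡ ℤ.- + 1 →
  + target (5 ℕ.+ m) ℤ.< + 3 ℤ.* lowerSum (5 ℕ.+ m)
target<3*lowerSum-from20 m 15≤m m-odd = subst (λ σ → + target n ℤ.< + 3 ℤ.* σ) (sym split)
  (<-3*[s+z-b+c] {s = Σ} {b = T₂ ℕ.* n} {c = T₁ ℕ.* (4 ℕ.+ m)}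
     head (ℤP.≤-reflexive (sym class₋₃)) (tail-bound m 15≤m))
  where
  n = 5 ℕ.+ m
  Σ = sumℤ 2 m (negClassGap n)
  T₁ = cycleCount n (4 ℕ.+ m)
  T₂ = cycleCount n (3 ℕ.+ m)
  T₄ = cycleCount n (1 ℕ.+ m)
  m+1-even : signℤ (suc m) ≡ + 1
  m+1-even = trans (signℤ-suc m) (cong ℤ.-_ m-odd)
  head : 0ℤ ℤ.≤ + 3 ℤ.* Σ ℤ.+ + ((4 ℕ.+ m) ℕ.* (10 ℕ.* T₄))
  head = subst (λ x → 0ℤ ℤ.≤ + 3 ℤ.* Σ ℤ.+ x)
    (sym (trans (ℤP.pos-* (4 ℕ.+ m) (10 ℕ.* T₄)) (cong (λ x → + (4 ℕ.+ m) ℤ.* x) (ℤP.pos-* 10 T₄))))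
    (negClassGap-sum-lower (4 ℕ.+ m) m ℕP.≤-refl)
  class₋₃ : negClassGap n (2 ℕ.+ m) ≡ 0ℤ
  class₋₃ = trans (cong (λ g → + cycleCount n (2 ℕ.+ m) ℤ.* (g ⊓ 0ℤ)) (charGap-even (4 ℕ.+ m) (2 ℕ.+ m) m+1-even))
                  (ℤP.*-zeroʳ (+ cycleCount n (2 ℕ.+ m)))
  class₋₂ : negClassGap n (3 ℕ.+ m) ≡ ℤ.- + (T₂ ℕ.* n)
  class₋₂ = begin
    + T₂ ℤ.* (charGap n (3 ℕ.+ m) ⊓ 0ℤ)
      ≡⟨ cong (λ g → + T₂ ℤ.* (g ⊓ 0ℤ)) (trans (charGap-odd (4 ℕ.+ m) (3 ℕ.+ m) m-odd) (simplify (+ m))) ⟩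
    + T₂ ℤ.* ℤ.- + n   ≡⟨ ℤP.neg-distribʳ-* (+ T₂) (+ n) ⟨
    ℤ.- (+ T₂ ℤ.* + n) ≡⟨ cong ℤ.-_ (ℤP.pos-* T₂ n) ⟨
    ℤ.- + (T₂ ℕ.* n)   ∎
    where
    open ≡-Reasoning
    simplify : ∀ m → (+ 3 ℤ.+ m) ℤ.- ((+ 4 ℤ.+ m) ℤ.+ (+ 4 ℤ.+ m)) ≡ ℤ.- (+ 5 ℤ.+ m)
    simplify = ℤ-Solver.solve-∀
  class₋₁ : classGap n (4 ℕ.+ m) ≡ + (T₁ ℕ.* (4 ℕ.+ m))
  class₋₁ = trans (cong (+ T₁ ℤ.*_) (charGap-even (4 ℕ.+ m) (4 ℕ.+ m) m+1-even)) (sym (ℤP.pos-* T₁ (4 ℕ.+ m)))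
  split : lowerSum n ≡ Σ ℤ.+ negClassGap n (2 ℕ.+ m) ℤ.+ ℤ.- + (T₂ ℕ.* n) ℤ.+ + (T₁ ℕ.* (4 ℕ.+ m))
  split = begin
    sumℤ 2 (2 ℕ.+ m) (negClassGap n) ℤ.+ classGap n (4 ℕ.+ m)
      ≡⟨ cong₂ ℤ._+_ (sumℤ-snoc 2 (1 ℕ.+ m) (negClassGap n)) class₋₁ ⟩
    sumℤ 2 (1 ℕ.+ m) (negClassGap n) ℤ.+ negClassGap n (3 ℕ.+ m) ℤ.+ + (T₁ ℕ.* (4 ℕ.+ m))
      ≡⟨ cong (λ x → x ℤ.+ + (T₁ ℕ.* (4 ℕ.+ m))) (cong₂ ℤ._+_ (sumℤ-snoc 2 m (negClassGap n)) class₋₂) ⟩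
    Σ ℤ.+ negClassGap n (2 ℕ.+ m) ℤ.+ ℤ.- + (T₂ ℕ.* n) ℤ.+ + (T₁ ℕ.* (4 ℕ.+ m)) ∎
    where open ≡-Reasoning

target<3*lowerSum : ∀ q → 4 ≤ q → + target (q ℕ.* 2) ℤ.< + 3 ℤ.* lowerSum (q ℕ.* 2)
target<3*lowerSum 1 (s≤s ())
target<3*lowerSum 2 (s≤s (s≤s ()))
target<3*lowerSum 3 (s≤s (s≤s (s≤s ())))
target<3*lowerSum 4 _ = toWitness {a? = + target 8 ℤ.<? + 3 ℤ.* lowerSum 8} tt
target<3*lowerSum 5 _ = toWitness {a? = + target 10 ℤ.<? + 3 ℤ.* lowerSum 10} tt
target<3*lowerSum 6 _ = toWitness {a? = + target 12 ℤ.<? + 3 ℤ.* lowerSum 12} tt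
target<3*lowerSum 7 _ = toWitness {a? = + target 14 ℤ.<? + 3 ℤ.* lowerSum 14} tt
target<3*lowerSum 8 _ = toWitness {a? = + target 16 ℤ.<? + 3 ℤ.* lowerSum 16} tt
target<3*lowerSum 9 _ = toWitness {a? = + target 18 ℤ.<? + 3 ℤ.* lowerSum 18} tt
target<3*lowerSum q@(suc (suc (suc (suc (suc (suc (suc (suc (suc (suc j)))))))))) _ =
  subst (λ n → + target n ℤ.< + 3 ℤ.* lowerSum n) n≡q*2
    (target<3*lowerSum-from20 (15 ℕ.+ j ℕ.* 2) (ℕP.m≤m+n 15 _) (signℤ-odd j))
  where
  n≡q*2 : 5 ℕ.+ (15 ℕ.+ j ℕ.* 2) ≡ q ℕ.* 2
  n≡q*2 = refl

target-scaled : ∀ n → ℤ→ℚ (+ 3) ℚ.* ((+ (n ℕ.* (n ∸ 5))) / 3 ℚ.* ℕ→ℚ ((n ∸ 3) !) ℚ.* ℤ→ℚ (+ (n ∸ 1)))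
                      ≡ ℤ→ℚ (+ target n)
target-scaled n = begin
  three ℚ.* ((+ A) / 3 ℚ.* ℕ→ℚ G ℚ.* q)   ≡⟨ regroup three ((+ A) / 3) (ℕ→ℚ G) q ⟩
  (+ A) / 3 ℚ.* three ℚ.* ℕ→ℚ G ℚ.* q     ≡⟨ cong (λ x → x ℚ.* ℕ→ℚ G ℚ.* q) (z/[1+d]*[1+d]≡z (+ A) 2) ⟩
  ℤ→ℚ (+ A) ℚ.* ℕ→ℚ G ℚ.* q               ≡⟨ cong (ℚ._* q) (ℤ→ℚ-* (+ A) (+ G)) ⟨
  ℤ→ℚ (+ A ℤ.* + G) ℚ.* q                 ≡⟨ ℤ→ℚ-* (+ A ℤ.* + G) (+ (n ∸ 1)) ⟨
  ℤ→ℚ (+ A ℤ.* + G ℤ.* + (n ∸ 1))         ≡⟨ cong ℤ→ℚ (trans (ℤP.pos-* (A ℕ.* G) (n ∸ 1))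
                                                            (cong (ℤ._* + (n ∸ 1)) (ℤP.pos-* A G))) ⟨
  ℤ→ℚ (+ target n)                        ∎
  where
  open ≡-Reasoning
  A = n ℕ.* (n ∸ 5)
  G = (n ∸ 3) !
  three = ℤ→ℚ (+ 3)
  q = ℤ→ℚ (+ (n ∸ 1))
  regroup : ∀ (t a c q : ℚ) → t ℚ.* (a ℚ.* c ℚ.* q) ≡ a ℚ.* t ℚ.* c ℚ.* q
  regroup = solve 4 (λ t a c q → t :* (a :* c :* q) := a :* t :* c :* q) refl
    where open +-*-Solver

lamSign-lamStd-bound : ∀ n → 3 ≤ n → (I : ℕ → Bool) → I (n ∸ 1) ≡ true →
  (∀ k → I k ≡ true → 2 ≤ k × k ≤ n ∸ 1) → + target n ℤ.< + 3 ℤ.* lowerSum n →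
  (+ (n ℕ.* (n ∸ 5))) / 3 ℚ.* ℕ→ℚ ((n ∸ 3) !) ℚ.< lamSign n I ℚ.- lamStd n I
lamSign-lamStd-bound 1 (s≤s ())
lamSign-lamStd-bound 2 (s≤s (s≤s ()))
lamSign-lamStd-bound n@(suc (suc (suc m))) _ I top∈I I⊆ key =
  ℚP.*-cancelʳ-<-nonNeg q {{ℚP.normalize-nonNeg (2 ℕ.+ m) 1}}
    (ℚP.*-cancelˡ-<-nonNeg three {{ℚP.normalize-nonNeg 3 1}} (begin-strict
      three ℚ.* (L ℚ.* q)          ≡⟨ target-scaled n ⟩
      ℤ→ℚ (+ target n)             <⟨ ℤ→ℚ-mono-< key ⟩
      ℤ→ℚ (+ 3 ℤ.* lowerSum n)     ≤⟨ ℤ→ℚ-mono-≤ (ℤP.*-monoˡ-≤-nonNeg (+ 3) (lowerSum≤selectedSum m I top∈I I⊆)) ⟩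
      ℤ→ℚ (+ 3 ℤ.* selectedSum)    ≡⟨ ℤ→ℚ-* (+ 3) selectedSum ⟩
      three ℚ.* ℤ→ℚ selectedSum    ≡⟨ cong (three ℚ.*_) (lamSign-lamStd-scaled (suc m) I) ⟨
      three ℚ.* (D ℚ.* q)          ∎))
  where
  open ℚP.≤-Reasoning
  three = ℤ→ℚ (+ 3)
  q = ℤ→ℚ (+ (2 ℕ.+ m))
  L = (+ (n ℕ.* (n ∸ 5))) / 3 ℚ.* ℕ→ℚ ((n ∸ 3) !)
  D = lamSign n I ℚ.- lamStd n I
  selectedSum = sumℤ 2 (2 ℕ.+ m) (λ k → if I k then classGap n k else 0ℤ)

lemma4p1 : (n : ℕ) → 8 ≤ n → 2 ∣ n → (I : ℕ → Bool) →
    I (n ∸ 1) ≡ true →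
    (∀ k → I k ≡ true → 2 ≤ k × k ≤ n ∸ 1) →
    ((+ (n *ℕ (n ∸ 5))) / 3) * ℕ→ℚ ((n ∸ 3) !) < lamSign n I - lamStd n I
lemma4p1 n 8≤n (divides q refl) I n-1∈I I⊆ =
  lamSign-lamStd-bound n (ℕP.≤-trans (s≤s (s≤s (s≤s z≤n))) 8≤n) I n-1∈I I⊆
    (target<3*lowerSum q (ℕP.*-cancelʳ-≤ 4 q 2 8≤n))
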